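{- For all integers $N\ge 0$, $j\ge0$ and $n\ge0$, there is a bijection between Frobenius symbols of weight $n$ with $N$ columns whose bottom row has exactly $j$ overlined entries, and overpartitions of $n$ whose generalized Durfee square has size $N$ and which have exactly $N-j$ overlined parts.
   Context: An overpartition of $n$ is a non-increasing sequence of positive integers summing to $n$ in which the final occurrence of each value may be overlined. A Frobenius symbol with $N$ columns is a two-rowed array $\begin{pmatrix}a_1&\cdots&a_N\\ b_1&\cdots&b_N\end{pmatrix}$ where $a_1>\cdots>a_N\ge0$ are integers and $b_1\ge\cdots\ge b_N\ge0$ are integers in which the first occurrence of each value may be overlined; its weight is $N+\sum_m(a_m+b_m)$. (Frobenius symbols are the Frobenius representations of overpartitions.) The generalized Durfee square of an overpartition has size $N$, where $N$ is the largest integer such that the number of overlined parts plus the number of non-overlined parts greater than or equal to $N$ is at least $N$. -}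

module Defs where

open import Data.Nat using (ℕ; zero; suc; _+_; _≤ᵇ_; _<ᵇ_; _≡ᵇ_)
open import Data.Bool using (Bool; true; false; _∧_; if_then_else_; not)
open import Data.Product using (Σ; _×_; _,_)
open import Data.List using (List; []; _∷_; length)
open import Data.Vec using (Vec; []; _∷_)
open import Data.Unit using (⊤)
open import Data.Bool using (T)
open import Data.Integer using (ℤ; +_)
import Data.Integer.Properties as ℤP
open import Relation.Binary.PropositionalEquality using (_≡_)
open import Relation.Nullary.Decidable using (⌊_⌋)

-- An overpartition is a list of parts (value , overlined?) such that
--  * every value is positive,
--  * values are non-increasing,
--  * only the final occurrence of a value may be overlined, i.e. an
--    overlined part is followed (if at all) by a strictly smaller value.

Part : Set
Part = ℕ × Bool

validOPFrom : Part → List Part → Bool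
validOPFrom (v , o) [] = true
validOPFrom (v , o) ((w , p) ∷ ps) =
  (w ≤ᵇ v) ∧ (if o then w <ᵇ v else true) ∧ validOPFrom (w , p) ps

allPositive : List Part → Bool
allPositive [] = true
allPositive ((v , _) ∷ ps) = (1 ≤ᵇ v) ∧ allPositive ps

validOP : List Part → Bool
validOP [] = true
validOP (p ∷ ps) = allPositive (p ∷ ps) ∧ validOPFrom p ps

sumParts : List Part → ℕ
sumParts [] = 0
sumParts ((v , _) ∷ ps) = v + sumParts ps

numOverlined : List Part → ℕ
numOverlined [] = 0
numOverlined ((_ , true) ∷ ps) = suc (numOverlined ps)
numOverlined ((_ , false) ∷ ps) = numOverlined ps

durfeeCount : ℕ → List Part → ℕ
durfeeCount k [] = 0
durfeeCount k ((_ , true) ∷ ps) = suc (durfeeCount k ps)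
durfeeCount k ((v , false) ∷ ps) =
  if k ≤ᵇ v then suc (durfeeCount k ps) else durfeeCount k ps

durfeeSearch : List Part → ℕ → ℕ
durfeeSearch λ' zero = zero
durfeeSearch λ' (suc k) =
  if suc k ≤ᵇ durfeeCount (suc k) λ' then suc k else durfeeSearch λ' k

-- size of the generalized Durfee square: the largest N with
-- durfeeCount N λ ≥ N.  Since durfeeCount N λ ≤ length λ, such N is
-- at most length λ, so searching downwards from length λ is exhaustive.
durfeeSize : List Part → ℕ
durfeeSize λ' = durfeeSearch λ' (length λ')

OverpartitionsDurfee : (n N : ℕ) (m : ℤ) → Set
OverpartitionsDurfee n N m =
  Σ (List Part) λ λ' →
    T (validOP λ' ∧ (sumParts λ' ≡ᵇ n) ∧ (durfeeSize λ' ≡ᵇ N)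
        ∧ ⌊ + numOverlined λ' ℤP.≟ m ⌋)

-- top row a₁ > ⋯ > a_N ≥ 0 (naturals), bottom row b₁ ≥ ⋯ ≥ b_N ≥ 0
-- where only the first occurrence of a value may be overlined, i.e. an
-- overlined entry b_i (i > 1) requires b_{i-1} > b_i.

strictDecr : ∀ {N} → Vec ℕ N → Bool
strictDecr [] = true
strictDecr (a ∷ []) = true
strictDecr (a ∷ (a' ∷ as)) = (a' <ᵇ a) ∧ strictDecr (a' ∷ as)

validBottom : ∀ {N} → Vec Part N → Bool
validBottom [] = true
validBottom (b ∷ []) = true
validBottom ((v , o) ∷ ((w , p) ∷ bs)) =
  (w ≤ᵇ v) ∧ (if p then w <ᵇ v else true) ∧ validBottom ((w , p) ∷ bs)

sumVec : ∀ {N} → Vec ℕ N → ℕ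
sumVec [] = 0
sumVec (a ∷ as) = a + sumVec as

sumBottom : ∀ {N} → Vec Part N → ℕ
sumBottom [] = 0
sumBottom ((v , _) ∷ bs) = v + sumBottom bs

numOverlinedVec : ∀ {N} → Vec Part N → ℕ
numOverlinedVec [] = 0
numOverlinedVec ((_ , true) ∷ bs) = suc (numOverlinedVec bs)
numOverlinedVec ((_ , false) ∷ bs) = numOverlinedVec bs

frobWeight : ∀ {N} → Vec ℕ N → Vec Part N → ℕ
frobWeight {N} as bs = N + (sumVec as + sumBottom bs)

FrobeniusSymbols : (n N j : ℕ) → Set
FrobeniusSymbols n N j =
  Σ (Vec ℕ N × Vec Part N) λ { (as , bs) →
    T (strictDecr as ∧ validBottom bs ∧ (frobWeight as bs ≡ᵇ n)
        ∧ (numOverlinedVec bs ≡ᵇ j)) }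

-- Split the bottom row of a Frobenius symbol into its overlined entries d₁ > ⋯ > dⱼ and its plain
-- entries m₁ ≥ ⋯ ≥ mₖ, k = N - j. The overpartition has the k overlined parts mᵢ + (k - i) + 1, the
-- j plain parts N + dᵢ - (j - i) ≥ N, and as its remaining plain parts, all at most N, the partition
-- whose conjugate has parts aᵢ - (N - i). Each piece is recovered by removing the staircase again or
-- by conjugating back. At least N parts are overlined or at least N, but at most N are overlined or
-- at least N + 1, so the generalized Durfee square has size N; conversely, given N - j overlined
-- parts, this Durfee condition forces the j largest plain parts to be at least N and the others to
-- be at most N. The staircases change the weight by (k + Δ(k)) + (jN - Δ(j)) - Δ(N) = N, where
-- Δ(n) = n(n - 1)/2, and this N is the number of columns counted in the weight of the symbol.

module Submission where

open import Defs

import Algebra.Properties.CommutativeSemigroup as CommutativeSemigroupₚ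
open import Data.Bool using (Bool; true; false; _∧_; if_then_else_; T)
open import Data.Bool.Properties using (T-∧; T-irrelevant)
open import Data.Empty using (⊥-elim)
open import Data.Integer using (+_; _-_; _⊖_) renaming (_+_ to _ℤ+_)
import Data.Integer.Properties as ℤ
open import Data.List using (List; []; _∷_; length; map; _++_; take; drop; replicate)
open import Data.List.Properties
  using (length-map; length-++; length-replicate; length-take; take++drop≡id; map-∘; map-id; map-id-local)
open import Data.List.Relation.Unary.All as All using (All; []; _∷_)
import Data.List.Relation.Unary.All.Properties as Allₚ
open Allₚ using (++⁺; drop⁺; replicate⁺)
open import Data.List.Relation.Unary.Linked as Linked using (Linked; []; [-]; _∷_)
import Data.List.Relation.Unary.Linked.Properties as Linkedₚ
open Linkedₚ using (Linked⇒All)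
open import Data.Nat
  using (ℕ; zero; suc; _+_; _*_; _⊔_; _∸_; _≤_; _<_; _≥_; _>_; z≤n; s≤s; s≤s⁻¹; _≤ᵇ_; _<ᵇ_; _≡ᵇ_; pred)
open import Data.Nat.ListAction using (sum)
open import Data.Nat.ListAction.Properties using (sum-++)
open import Data.Nat.Properties
open import Data.Nat.Tactic.RingSolver using (solve-∀)
open import Data.Product using (_×_; _,_; proj₁; proj₂)
open import Data.Product.Properties using (Σ-≡,≡→≡)
open import Data.Unit using (tt)
open import Data.Vec using (Vec; []; _∷_; toList)
import Data.Vec as Vec
open import Data.Vec.Properties using (length-toList)
open import Function.Bundles using (_⤖_; Equivalence; mk↔ₛ′)
open import Function.Properties.Inverse using (↔⇒⤖)
open import Relation.Binary.PropositionalEquality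
open import Relation.Nullary using (¬_; yes; no)
open import Relation.Nullary.Decidable using (⌊_⌋; toWitness; fromWitness)
open import Relation.Nullary.Reflects using (ofʸ; ofⁿ)

open CommutativeSemigroupₚ +-commutativeSemigroup using (interchange; x∙yz≈y∙xz)

∧-intro : ∀ {x y} → T x → T y → T (x ∧ y)
∧-intro p q = Equivalence.from T-∧ (p , q)

∧-elim : ∀ {x y} → T (x ∧ y) → T x × T y
∧-elim = Equivalence.to T-∧

≤ᵇ-true : ∀ {m n} → m ≤ n → (m ≤ᵇ n) ≡ true
≤ᵇ-true {m} {n} m≤n with m ≤ᵇ n | ≤ᵇ-reflects-≤ m n
... | true  | _ = refl
... | false | ofⁿ m≰n = ⊥-elim (m≰n m≤n)

≤ᵇ-false : ∀ {m n} → n < m → (m ≤ᵇ n) ≡ false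
≤ᵇ-false {m} {n} n<m with m ≤ᵇ n | ≤ᵇ-reflects-≤ m n
... | true  | ofʸ m≤n = ⊥-elim (<⇒≱ n<m m≤n)
... | false | _ = refl

<ᵇ-true : ∀ {m n} → m < n → (m <ᵇ n) ≡ true
<ᵇ-true = ≤ᵇ-true

<ᵇ-false : ∀ {m n} → n ≤ m → (m <ᵇ n) ≡ false
<ᵇ-false n≤m = ≤ᵇ-false (s≤s n≤m)

if-elim : ∀ {A : Set} (P : A → Set) b {x y} → (T b → P x) → (¬ T b → P y) → P (if b then x else y)
if-elim P true px _ = px tt
if-elim P false _ py = py λ ()

∧-elim₄ : ∀ {w x y z} → T (w ∧ x ∧ y ∧ z) → T w × T x × T y × T z
∧-elim₄ {w} {x} {y} t =
  let tw , t′ = ∧-elim {w} t ; tx , t″ = ∧-elim {x} t′ ; ty , tz = ∧-elim {y} t″ in tw , tx , ty , tz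

∧-intro₄ : ∀ {w x y z} → T w → T x → T y → T z → T (w ∧ x ∧ y ∧ z)
∧-intro₄ tw tx ty tz = ∧-intro tw (∧-intro tx (∧-intro ty tz))

-- Monotone lists and staircases
NonIncreasing : List ℕ → Set
NonIncreasing = Linked _≥_

Decreasing : List ℕ → Set
Decreasing = Linked _>_

nonIncreasing⇒bounded : ∀ {x xs} → NonIncreasing (x ∷ xs) → All (_≤ x) xs
nonIncreasing⇒bounded [-] = []
nonIncreasing⇒bounded (x≥y ∷ ys) = Linked⇒All (λ p q → ≤-trans q p) x≥y ys

decreasing⇒bounded : ∀ {x xs} → Decreasing (x ∷ xs) → All (_< x) xs
decreasing⇒bounded [-] = []
decreasing⇒bounded (x>y ∷ ys) = Linked⇒All (λ p q → <-trans q p) x>y ys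

decreasing⇒length≤head : ∀ {x xs} → Decreasing (x ∷ xs) → length xs ≤ x
decreasing⇒length≤head [-] = z≤n
decreasing⇒length≤head (x>y ∷ ys) = ≤-trans (s≤s (decreasing⇒length≤head ys)) x>y

take-nonIncreasing : ∀ n {xs} → NonIncreasing xs → NonIncreasing (take n xs)
take-nonIncreasing zero _ = []
take-nonIncreasing (suc n) [] = []
take-nonIncreasing (suc zero) [-] = [-]
take-nonIncreasing (suc (suc n)) [-] = [-]
take-nonIncreasing (suc zero) (_ ∷ _) = [-]
take-nonIncreasing (suc (suc n)) (x≥y ∷ ys) = x≥y ∷ take-nonIncreasing (suc n) ys

drop-nonIncreasing : ∀ n {xs} → NonIncreasing xs → NonIncreasing (drop n xs)
drop-nonIncreasing zero xs = xs
drop-nonIncreasing (suc n) [] = []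
drop-nonIncreasing (suc n) [-] = drop-nonIncreasing n []
drop-nonIncreasing (suc n) (_ ∷ ys) = drop-nonIncreasing n ys

cons-decreasing : ∀ {x xs} → All (_< x) xs → Decreasing xs → Decreasing (x ∷ xs)
cons-decreasing [] [] = [-]
cons-decreasing (y<x ∷ _) dec = y<x ∷ dec

replicate-nonIncreasing : ∀ n x → NonIncreasing (replicate n x)
replicate-nonIncreasing zero x = []
replicate-nonIncreasing (suc zero) x = [-]
replicate-nonIncreasing (suc (suc n)) x = ≤-refl ∷ replicate-nonIncreasing (suc n) x

map-suc-nonIncreasing : ∀ {xs} → NonIncreasing xs → NonIncreasing (map suc xs)
map-suc-nonIncreasing ni = Linkedₚ.map⁺ (Linked.map s≤s ni)

cons-nonIncreasing : ∀ {x xs} → All (_≤ x) xs → NonIncreasing xs → NonIncreasing (x ∷ xs)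
cons-nonIncreasing [] [] = [-]
cons-nonIncreasing (y≤x ∷ _) ni = y≤x ∷ ni

++-nonIncreasing : ∀ N {xs ys} → NonIncreasing xs → NonIncreasing ys → All (N ≤_) xs → All (_≤ N) ys →
                   NonIncreasing (xs ++ ys)
++-nonIncreasing N [] ni _ _ = ni
++-nonIncreasing N {x ∷ xs} niₓ ni (N≤x ∷ large) small =
  cons-nonIncreasing (++⁺ (nonIncreasing⇒bounded niₓ) (All.map (λ y≤N → ≤-trans y≤N N≤x) small))
                     (++-nonIncreasing N (Linked.tail niₓ) ni large small)

top : List ℕ → ℕ
top [] = 0
top (x ∷ _) = x

nonIncreasing⇒≤top : ∀ {xs} → NonIncreasing xs → All (_≤ top xs) xs
nonIncreasing⇒≤top [] = []
nonIncreasing⇒≤top ni@[-] = ≤-refl ∷ nonIncreasing⇒bounded ni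
nonIncreasing⇒≤top ni@(_ ∷ _) = ≤-refl ∷ nonIncreasing⇒bounded ni

decreasing⇒≤top : ∀ {xs} → Decreasing xs → All (_≤ top xs) xs
decreasing⇒≤top dec = nonIncreasing⇒≤top (Linked.map <⇒≤ dec)

bounded⇒positive : ∀ {N xs} → All (N ≤_) xs → length xs ≤ N → All (1 ≤_) xs
bounded⇒positive [] _ = []
bounded⇒positive large@(N≤x ∷ _) (s≤s _) = All.map (≤-trans (s≤s z≤n)) large

length-take≡ : ∀ j {xs : List ℕ} → j ≤ length xs → length (take j xs) ≡ j
length-take≡ j {xs} j≤length = trans (length-take j xs) (m≤n⇒m⊓n≡m j≤length)

take-++-length : ∀ (xs ys : List ℕ) → take (length xs) (xs ++ ys) ≡ xs
take-++-length [] ys = refl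
take-++-length (x ∷ xs) ys = cong (x ∷_) (take-++-length xs ys)

drop-++-length : ∀ (xs ys : List ℕ) → drop (length xs) (xs ++ ys) ≡ ys
drop-++-length [] ys = refl
drop-++-length (x ∷ xs) ys = drop-++-length xs ys

stair : List ℕ → List ℕ
stair [] = []
stair (x ∷ xs) = x + length xs ∷ stair xs

unstair : List ℕ → List ℕ
unstair [] = []
unstair (x ∷ xs) = x ∸ length xs ∷ unstair xs

length-stair : ∀ xs → length (stair xs) ≡ length xs
length-stair [] = refl
length-stair (x ∷ xs) = cong suc (length-stair xs)

length-unstair : ∀ xs → length (unstair xs) ≡ length xs
length-unstair [] = refl
length-unstair (x ∷ xs) = cong suc (length-unstair xs)

stair-decreasing : ∀ {xs} → NonIncreasing xs → Decreasing (stair xs)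
stair-decreasing [] = []
stair-decreasing [-] = [-]
stair-decreasing {_ ∷ _ ∷ ys} (x≥y ∷ rest) =
  +-mono-≤-< x≥y (n<1+n (length ys)) ∷ stair-decreasing rest

unstair-nonIncreasing : ∀ {xs} → Decreasing xs → NonIncreasing (unstair xs)
unstair-nonIncreasing [] = []
unstair-nonIncreasing [-] = [-]
unstair-nonIncreasing {x ∷ y ∷ ys} (y<x ∷ rest) =
  ∸-monoˡ-≤ (suc (length ys)) y<x
  ∷ unstair-nonIncreasing rest

unstair-stair : ∀ xs → unstair (stair xs) ≡ xs
unstair-stair [] = refl
unstair-stair (x ∷ xs) =
  cong₂ _∷_ (trans (cong (x + length xs ∸_) (length-stair xs)) (m+n∸n≡m x (length xs)))
            (unstair-stair xs)

stair-unstair : ∀ {xs} → Decreasing xs → stair (unstair xs) ≡ xs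
stair-unstair [] = refl
stair-unstair {x ∷ xs} dec =
  cong₂ _∷_ (trans (cong (_+_ (x ∸ length xs)) (length-unstair xs)) (m∸n+n≡m (decreasing⇒length≤head dec)))
            (stair-unstair (Linked.tail dec))

triangle : ℕ → ℕ
triangle zero = 0
triangle (suc n) = n + triangle n

sum-stair : ∀ xs → sum (stair xs) ≡ sum xs + triangle (length xs)
sum-stair [] = refl
sum-stair (x ∷ xs) = begin
  x + length xs + sum (stair xs)                  ≡⟨ cong (_+_ (x + length xs)) (sum-stair xs) ⟩
  x + length xs + (sum xs + triangle (length xs)) ≡⟨ interchange x (length xs) (sum xs) _ ⟩
  x + sum xs + (length xs + triangle (length xs)) ∎
  where open ≡-Reasoning

triangle-+ : ∀ k j → triangle (k + j) ≡ triangle k + triangle j + k * j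
triangle-+ zero j = sym (+-identityʳ (triangle j))
triangle-+ (suc k) j = begin
  k + j + triangle (k + j)                        ≡⟨ cong (_+_ (k + j)) (triangle-+ k j) ⟩
  k + j + (triangle k + triangle j + k * j)       ≡⟨ rearrange k j (triangle k) (triangle j) ⟩
  k + triangle k + triangle j + suc k * j         ∎
  where
  open ≡-Reasoning
  rearrange : ∀ k j a b → k + j + (a + b + k * j) ≡ k + a + b + (1 + k) * j
  rearrange = solve-∀

triangle-double : ∀ j → j + triangle j + triangle j ≡ j * j
triangle-double zero = refl
triangle-double (suc j) = begin
  suc j + (j + triangle j) + (j + triangle j) ≡⟨ rearrange j (triangle j) ⟩
  suc j + j + (j + triangle j + triangle j)   ≡⟨ cong (_+_ (suc j + j)) (triangle-double j) ⟩
  suc j + j + j * j                           ≡⟨ square j ⟩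
  suc j * suc j                               ∎
  where
  open ≡-Reasoning
  rearrange : ∀ j t → 1 + j + (j + t) + (j + t) ≡ 1 + j + j + (j + t + t)
  rearrange = solve-∀
  square : ∀ j → 1 + j + j + j * j ≡ (1 + j) * (1 + j)
  square = solve-∀

sum-map-+ : ∀ N xs → sum (map (_+_ N) xs) ≡ length xs * N + sum xs
sum-map-+ N [] = refl
sum-map-+ N (x ∷ xs) = begin
  N + x + sum (map (_+_ N) xs)     ≡⟨ cong (_+_ (N + x)) (sum-map-+ N xs) ⟩
  N + x + (length xs * N + sum xs) ≡⟨ interchange N x (length xs * N) (sum xs) ⟩
  N + length xs * N + (x + sum xs) ∎
  where open ≡-Reasoning

-- Conjugation: partitions with parts at most N versus decreasing top rows
PartsAtMost : ℕ → List ℕ → Set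
PartsAtMost N xs = NonIncreasing xs × All (λ v → 1 ≤ v × v ≤ N) xs

partsAtMost⇒positive : ∀ {N xs} → PartsAtMost N xs → All (1 ≤_) xs
partsAtMost⇒positive (_ , bounds) = All.map proj₁ bounds

partsAtMost-zero : ∀ {xs} → PartsAtMost 0 xs → xs ≡ []
partsAtMost-zero (_ , []) = refl
partsAtMost-zero (_ , (1≤v , v≤0) ∷ _) = ⊥-elim (<⇒≱ 1≤v v≤0)

partsAtMost-one : ∀ {xs} → PartsAtMost 1 xs → xs ≡ replicate (length xs) 1
partsAtMost-one (_ , []) = refl
partsAtMost-one (ni , (s≤s z≤n , s≤s z≤n) ∷ bounds) = cong (1 ∷_) (partsAtMost-one (Linked.tail ni , bounds))

dropColumn : List ℕ → List ℕ
dropColumn [] = []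
dropColumn (zero ∷ xs) = dropColumn xs
dropColumn (suc zero ∷ xs) = dropColumn xs
dropColumn (suc (suc v) ∷ xs) = suc v ∷ dropColumn xs

countOnes : List ℕ → ℕ
countOnes [] = 0
countOnes (zero ∷ xs) = countOnes xs
countOnes (suc zero ∷ xs) = suc (countOnes xs)
countOnes (suc (suc v) ∷ xs) = countOnes xs

dropColumn⁺ : ∀ {P Q : ℕ → Set} → (∀ {v} → P (suc (suc v)) → Q (suc v)) →
              ∀ {xs} → All P xs → All Q (dropColumn xs)
dropColumn⁺ f [] = []
dropColumn⁺ f {zero ∷ _} (_ ∷ ps) = dropColumn⁺ f ps
dropColumn⁺ f {suc zero ∷ _} (_ ∷ ps) = dropColumn⁺ f ps
dropColumn⁺ f {suc (suc v) ∷ _} (p ∷ ps) = f p ∷ dropColumn⁺ f ps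

dropColumn-ones : ∀ {xs} → All (_≤ 1) xs → dropColumn xs ≡ []
dropColumn-ones [] = refl
dropColumn-ones {zero ∷ _} (_ ∷ ps) = dropColumn-ones ps
dropColumn-ones {suc zero ∷ _} (_ ∷ ps) = dropColumn-ones ps
dropColumn-ones {suc (suc _) ∷ _} (s≤s () ∷ _)

dropColumn-map-suc : ∀ {xs} c → All (1 ≤_) xs → dropColumn (map suc xs ++ replicate c 1) ≡ xs
dropColumn-map-suc c [] = dropColumn-ones (replicate⁺ c ≤-refl)
dropColumn-map-suc {suc x ∷ _} c (_ ∷ ps) = cong (suc x ∷_) (dropColumn-map-suc c ps)

length-dropColumn≤ : ∀ xs → length (dropColumn xs) ≤ length xs
length-dropColumn≤ [] = z≤n
length-dropColumn≤ (zero ∷ xs) = m≤n⇒m≤1+n (length-dropColumn≤ xs)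
length-dropColumn≤ (suc zero ∷ xs) = m≤n⇒m≤1+n (length-dropColumn≤ xs)
length-dropColumn≤ (suc (suc v) ∷ xs) = s≤s (length-dropColumn≤ xs)

length-dropColumn : ∀ {xs} → All (1 ≤_) xs → length xs ≡ length (dropColumn xs) + countOnes xs
length-dropColumn [] = refl
length-dropColumn {suc zero ∷ xs} (_ ∷ ps) = trans (cong suc (length-dropColumn ps)) (sym (+-suc _ _))
length-dropColumn {suc (suc v) ∷ xs} (_ ∷ ps) = cong suc (length-dropColumn ps)

sum-dropColumn : ∀ {xs} → All (1 ≤_) xs → sum xs ≡ length xs + sum (dropColumn xs)
sum-dropColumn [] = refl
sum-dropColumn {suc zero ∷ xs} (_ ∷ ps) = cong suc (sum-dropColumn ps)
sum-dropColumn {suc (suc v) ∷ xs} (_ ∷ ps) = cong suc (begin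
  suc v + sum xs                            ≡⟨ cong (_+_ (suc v)) (sum-dropColumn ps) ⟩
  suc v + (length xs + sum (dropColumn xs)) ≡⟨ x∙yz≈y∙xz (suc v) (length xs) _ ⟩
  length xs + (suc v + sum (dropColumn xs)) ∎)
  where open ≡-Reasoning

dropColumn-nonIncreasing : ∀ {xs} → NonIncreasing xs → NonIncreasing (dropColumn xs)
dropColumn-nonIncreasing [] = []
dropColumn-nonIncreasing {zero ∷ _} ni = dropColumn-nonIncreasing (Linked.tail ni)
dropColumn-nonIncreasing {suc zero ∷ _} ni = dropColumn-nonIncreasing (Linked.tail ni)
dropColumn-nonIncreasing {suc (suc v) ∷ _} ni =
  cons-nonIncreasing (dropColumn⁺ s≤s⁻¹ (nonIncreasing⇒bounded ni))
                     (dropColumn-nonIncreasing (Linked.tail ni))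

dropColumn-partsAtMost : ∀ {N xs} → PartsAtMost (suc N) xs → PartsAtMost N (dropColumn xs)
dropColumn-partsAtMost (ni , bounds) =
  dropColumn-nonIncreasing ni , dropColumn⁺ (λ (_ , p) → s≤s z≤n , s≤s⁻¹ p) bounds

dropColumn-decomposition : ∀ {xs} → NonIncreasing xs → All (1 ≤_) xs →
                           xs ≡ map suc (dropColumn xs) ++ replicate (countOnes xs) 1
dropColumn-decomposition [] [] = refl
dropColumn-decomposition {suc zero ∷ xs} ni (_ ∷ ps) = begin
  1 ∷ xs                                                      ≡⟨ cong (1 ∷_) (dropColumn-decomposition (Linked.tail ni) ps) ⟩
  1 ∷ map suc (dropColumn xs) ++ replicate (countOnes xs) 1   ≡⟨ cong (λ ys → 1 ∷ map suc ys ++ replicate (countOnes xs) 1) noTwos ⟩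
  replicate (suc (countOnes xs)) 1                            ≡⟨ cong (λ ys → map suc ys ++ replicate (suc (countOnes xs)) 1) noTwos ⟨
  map suc (dropColumn xs) ++ replicate (suc (countOnes xs)) 1 ∎
  where
  open ≡-Reasoning
  noTwos : dropColumn xs ≡ []
  noTwos = dropColumn-ones (nonIncreasing⇒bounded ni)
dropColumn-decomposition {suc (suc v) ∷ xs} ni (_ ∷ ps) =
  cong (suc (suc v) ∷_) (dropColumn-decomposition (Linked.tail ni) ps)

-- The i-th entry of topRow N λ is (N - i) + λ′ᵢ, where λ′ is the conjugate of λ.
topRow : (N : ℕ) → List ℕ → Vec ℕ N
topRow zero xs = []
topRow (suc N) xs = N + length xs ∷ topRow N (dropColumn xs)

tailOf : ∀ {N} → Vec ℕ N → List ℕ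
tailOf [] = []
tailOf (x ∷ []) = replicate x 1
tailOf (x ∷ y ∷ ys) = map suc (tailOf (y ∷ ys)) ++ replicate (x ∸ suc y) 1

topRow-decreasing : ∀ N xs → T (strictDecr (topRow N xs))
topRow-decreasing zero xs = tt
topRow-decreasing (suc zero) xs = tt
topRow-decreasing (suc (suc N)) xs =
  ∧-intro (<⇒<ᵇ (s≤s (+-monoʳ-≤ N (length-dropColumn≤ xs))))
          (topRow-decreasing (suc N) (dropColumn xs))

tailOf-partsAtMost : ∀ {N} (a : Vec ℕ N) → T (strictDecr a) → PartsAtMost N (tailOf a)
tailOf-partsAtMost [] _ = [] , []
tailOf-partsAtMost (x ∷ []) _ = replicate-nonIncreasing x 1 , replicate⁺ x (≤-refl , ≤-refl)
tailOf-partsAtMost (x ∷ y ∷ ys) dec with tailOf-partsAtMost (y ∷ ys) (proj₂ (∧-elim dec))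
... | ni , bounds =
  ++-nonIncreasing 1 (map-suc-nonIncreasing ni) (replicate-nonIncreasing (x ∸ suc y) 1)
                     (Allₚ.map⁺ (All.map (λ _ → s≤s z≤n) bounds)) (replicate⁺ _ ≤-refl)
  , ++⁺ (Allₚ.map⁺ (All.map (λ (_ , v≤N) → s≤s z≤n , s≤s v≤N) bounds)) (replicate⁺ _ (≤-refl , s≤s z≤n))

tailOf-topRow : ∀ N {xs} → PartsAtMost N xs → tailOf (topRow N xs) ≡ xs
tailOf-topRow zero p = sym (partsAtMost-zero p)
tailOf-topRow (suc zero) p = sym (partsAtMost-one p)
tailOf-topRow (suc (suc N)) {xs} p@(ni , _) = begin
  map suc (tailOf (topRow (suc N) (dropColumn xs))) ++ replicate (suc N + length xs ∸ suc (N + length (dropColumn xs))) 1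
    ≡⟨ cong₂ (λ ys c → map suc ys ++ replicate c 1) (tailOf-topRow (suc N) (dropColumn-partsAtMost p)) ones ⟩
  map suc (dropColumn xs) ++ replicate (countOnes xs) 1
    ≡⟨ dropColumn-decomposition ni (partsAtMost⇒positive p) ⟨
  xs ∎
  where
  open ≡-Reasoning
  ones : suc N + length xs ∸ suc (N + length (dropColumn xs)) ≡ countOnes xs
  ones = begin
    N + length xs ∸ (N + length (dropColumn xs))                   ≡⟨ [m+n]∸[m+o]≡n∸o N _ _ ⟩
    length xs ∸ length (dropColumn xs)                             ≡⟨ cong (_∸ length (dropColumn xs)) (length-dropColumn (partsAtMost⇒positive p)) ⟩
    length (dropColumn xs) + countOnes xs ∸ length (dropColumn xs) ≡⟨ m+n∸m≡n (length (dropColumn xs)) _ ⟩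
    countOnes xs                                                   ∎

tailOf-∷-topRow : ∀ {N} x y (ys : Vec ℕ N) → y < x → T (strictDecr (y ∷ ys)) →
                  topRow (suc N) (tailOf (y ∷ ys)) ≡ y ∷ ys →
                  topRow (suc (suc N)) (tailOf (x ∷ y ∷ ys)) ≡ x ∷ y ∷ ys
tailOf-∷-topRow {N} x y ys y<x dec ih =
  cong₂ _∷_ headEq (trans (cong (topRow (suc N)) (dropColumn-map-suc _ positive)) ih)
  where
  open ≡-Reasoning
  tl : List ℕ
  tl = tailOf (y ∷ ys)
  positive : All (1 ≤_) tl
  positive = partsAtMost⇒positive (tailOf-partsAtMost (y ∷ ys) dec)
  headEq : suc N + length (map suc tl ++ replicate (x ∸ suc y) 1) ≡ x
  headEq = begin
    suc N + length (map suc tl ++ replicate (x ∸ suc y) 1)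
      ≡⟨ cong (_+_ (suc N)) (trans (length-++ (map suc tl)) (cong₂ _+_ (length-map suc tl) (length-replicate _))) ⟩
    suc N + (length tl + (x ∸ suc y))
      ≡⟨ cong suc (+-assoc N (length tl) _) ⟨
    suc (N + length tl) + (x ∸ suc y)
      ≡⟨ cong (λ z → suc z + (x ∸ suc y)) (cong Vec.head ih) ⟩
    suc y + (x ∸ suc y)
      ≡⟨ m+[n∸m]≡n y<x ⟩
    x ∎

topRow-tailOf : ∀ {N} (a : Vec ℕ N) → T (strictDecr a) → topRow N (tailOf a) ≡ a
topRow-tailOf [] _ = refl
topRow-tailOf (x ∷ []) _ = cong (_∷ []) (length-replicate x)
topRow-tailOf (x ∷ y ∷ ys) dec =
  tailOf-∷-topRow x y ys (<ᵇ⇒< y x (proj₁ (∧-elim dec))) (proj₂ (∧-elim dec))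
                  (topRow-tailOf (y ∷ ys) (proj₂ (∧-elim dec)))

sum-topRow : ∀ N {xs} → PartsAtMost N xs → sumVec (topRow N xs) ≡ triangle N + sum xs
sum-topRow zero p rewrite partsAtMost-zero p = refl
sum-topRow (suc N) {xs} p = begin
  N + length xs + sumVec (topRow N (dropColumn xs))     ≡⟨ cong (_+_ (N + length xs)) (sum-topRow N (dropColumn-partsAtMost p)) ⟩
  N + length xs + (triangle N + sum (dropColumn xs))    ≡⟨ interchange N (length xs) (triangle N) _ ⟩
  N + triangle N + (length xs + sum (dropColumn xs))    ≡⟨ cong (_+_ (N + triangle N)) (sum-dropColumn (partsAtMost⇒positive p)) ⟨
  N + triangle N + sum xs                               ∎
  where open ≡-Reasoning

overlinedParts : List Part → List ℕ
overlinedParts [] = []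
overlinedParts ((v , true) ∷ ps) = v ∷ overlinedParts ps
overlinedParts ((v , false) ∷ ps) = overlinedParts ps

plainParts : List Part → List ℕ
plainParts [] = []
plainParts ((v , true) ∷ ps) = plainParts ps
plainParts ((v , false) ∷ ps) = v ∷ plainParts ps

-- An overpartition
-- overlines the last occurrence of a value and a bottom row the first, which is all that
-- distinguishes mergeOP from mergeBottom below.
merge : (ℕ → ℕ → Bool) → List ℕ → List ℕ → List Part
merge before [] us = map (_, false) us
merge before (o ∷ os) [] = (o , true) ∷ merge before os []
merge before (o ∷ os) (u ∷ us) =
  if before o u then (o , true) ∷ merge before os (u ∷ us) else (u , false) ∷ merge before (o ∷ os) us

overlinedParts-merge : ∀ before os us → overlinedParts (merge before os us) ≡ os
overlinedParts-merge before [] [] = refl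
overlinedParts-merge before [] (u ∷ us) = overlinedParts-merge before [] us
overlinedParts-merge before (o ∷ os) [] = cong (o ∷_) (overlinedParts-merge before os [])
overlinedParts-merge before (o ∷ os) (u ∷ us) =
  if-elim (λ ps → overlinedParts ps ≡ o ∷ os) (before o u)
    (λ _ → cong (o ∷_) (overlinedParts-merge before os (u ∷ us)))
    (λ _ → overlinedParts-merge before (o ∷ os) us)

plainParts-merge : ∀ before os us → plainParts (merge before os us) ≡ us
plainParts-merge before [] [] = refl
plainParts-merge before [] (u ∷ us) = cong (u ∷_) (plainParts-merge before [] us)
plainParts-merge before (o ∷ os) [] = plainParts-merge before os []
plainParts-merge before (o ∷ os) (u ∷ us) =
  if-elim (λ ps → plainParts ps ≡ u ∷ us) (before o u)
    (λ _ → plainParts-merge before os (u ∷ us))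
    (λ _ → cong (u ∷_) (plainParts-merge before (o ∷ os) us))

merge-overlined : ∀ before {o os us} → All (λ u → before o u ≡ true) us →
                  merge before (o ∷ os) us ≡ (o , true) ∷ merge before os us
merge-overlined before [] = refl
merge-overlined before (o-before-u ∷ _) rewrite o-before-u = refl

merge-plain : ∀ before {u os us} → All (λ o → before o u ≡ false) os →
              merge before os (u ∷ us) ≡ (u , false) ∷ merge before os us
merge-plain before [] = refl
merge-plain before (u-before-o ∷ _) rewrite u-before-o = refl

sumParts-split : ∀ ps → sumParts ps ≡ sum (overlinedParts ps) + sum (plainParts ps)
sumParts-split [] = refl
sumParts-split ((v , true) ∷ ps) = trans (cong (_+_ v) (sumParts-split ps)) (sym (+-assoc v _ _))
sumParts-split ((v , false) ∷ ps) = trans (cong (_+_ v) (sumParts-split ps)) (x∙yz≈y∙xz v (sum (overlinedParts ps)) (sum (plainParts ps)))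

numOverlined≡length : ∀ ps → numOverlined ps ≡ length (overlinedParts ps)
numOverlined≡length [] = refl
numOverlined≡length ((v , true) ∷ ps) = cong suc (numOverlined≡length ps)
numOverlined≡length ((v , false) ∷ ps) = numOverlined≡length ps

length-split : ∀ ps → length ps ≡ length (overlinedParts ps) + length (plainParts ps)
length-split [] = refl
length-split ((v , true) ∷ ps) = cong suc (length-split ps)
length-split ((v , false) ∷ ps) = trans (cong suc (length-split ps)) (sym (+-suc _ _))

allPositive⇒positive : ∀ ps → T (allPositive ps) → All (1 ≤_) (overlinedParts ps) × All (1 ≤_) (plainParts ps)
allPositive⇒positive [] _ = [] , []
allPositive⇒positive ((v , o) ∷ ps) t with ∧-elim t
... | 1≤ᵇv , rest with allPositive⇒positive ps rest | o
...   | pos₁ , pos₂ | true = ≤ᵇ⇒≤ 1 v 1≤ᵇv ∷ pos₁ , pos₂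
...   | pos₁ , pos₂ | false = pos₁ , ≤ᵇ⇒≤ 1 v 1≤ᵇv ∷ pos₂

positive⇒allPositive : ∀ ps → All (1 ≤_) (overlinedParts ps) → All (1 ≤_) (plainParts ps) → T (allPositive ps)
positive⇒allPositive [] _ _ = tt
positive⇒allPositive ((v , true) ∷ ps) (1≤v ∷ pos₁) pos₂ = ∧-intro (≤⇒≤ᵇ 1≤v) (positive⇒allPositive ps pos₁ pos₂)
positive⇒allPositive ((v , false) ∷ ps) pos₁ (1≤v ∷ pos₂) = ∧-intro (≤⇒≤ᵇ 1≤v) (positive⇒allPositive ps pos₁ pos₂)

Below : Bool → ℕ → ℕ → Set
Below false v w = w ≤ v
Below true v w = w < v

below⇒≤ : ∀ s {v w} → Below s v w → w ≤ v
below⇒≤ false w≤v = w≤v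
below⇒≤ true w<v = <⇒≤ w<v

≤-below-trans : ∀ s {v w x} → x ≤ w → Below s v w → Below s v x
≤-below-trans false x≤w w≤v = ≤-trans x≤w w≤v
≤-below-trans true x≤w w<v = ≤-<-trans x≤w w<v

below-≤-trans : ∀ s {v w x} → Below s w x → w ≤ v → Below s v x
below-≤-trans false x≤w w≤v = ≤-trans x≤w w≤v
below-≤-trans true x<w w≤v = <-≤-trans x<w w≤v

step⇒ : ∀ s {v w rest} → T ((w ≤ᵇ v) ∧ (if s then w <ᵇ v else true) ∧ rest) → Below s v w × T rest
step⇒ false {v} {w} t = ≤ᵇ⇒≤ w v (proj₁ (∧-elim {w ≤ᵇ v} t)) , proj₂ (∧-elim {w ≤ᵇ v} t)
step⇒ true {v} {w} t with ∧-elim {w <ᵇ v} (proj₂ (∧-elim {w ≤ᵇ v} t))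
... | w<ᵇv , rest = <ᵇ⇒< w v w<ᵇv , rest

step⇐ : ∀ s {v w rest} → Below s v w → T rest → T ((w ≤ᵇ v) ∧ (if s then w <ᵇ v else true) ∧ rest)
step⇐ false w≤v r = ∧-intro (≤⇒≤ᵇ w≤v) (∧-intro tt r)
step⇐ true w<v r = ∧-intro (≤⇒≤ᵇ (<⇒≤ w<v)) (∧-intro (<⇒<ᵇ w<v) r)

All-split : ∀ {Q : Part → Set} {ps} → All Q ps →
            All (λ w → Q (w , true)) (overlinedParts ps) × All (λ w → Q (w , false)) (plainParts ps)
All-split [] = [] , []
All-split {ps = (w , true) ∷ _} (q ∷ qs) = q ∷ proj₁ (All-split qs) , proj₂ (All-split qs)
All-split {ps = (w , false) ∷ _} (q ∷ qs) = proj₁ (All-split qs) , q ∷ proj₂ (All-split qs)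

Ordered : List Part → Set
Ordered ps = Decreasing (overlinedParts ps) × NonIncreasing (plainParts ps)

∷-overlined-ordered : ∀ {v ps} → All (_< v) (overlinedParts ps) → Ordered ps → Ordered ((v , true) ∷ ps)
∷-overlined-ordered bound (dec , ni) = cons-decreasing bound dec , ni

∷-plain-ordered : ∀ {v ps} → All (_≤ v) (plainParts ps) → Ordered ps → Ordered ((v , false) ∷ ps)
∷-plain-ordered bound (dec , ni) = dec , cons-nonIncreasing bound ni

overlinedFirst : ℕ → ℕ → Bool
overlinedFirst o u = u <ᵇ o

mergeOP : List ℕ → List ℕ → List Part
mergeOP = merge overlinedFirst

validOPFrom⇒below : ∀ v o ps → T (validOPFrom (v , o) ps) → All (λ (w , _) → Below o v w) ps
validOPFrom⇒below v o [] _ = []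
validOPFrom⇒below v o ((w , p) ∷ ps) t with step⇒ o {v} {w} t
... | w-below-v , rest =
  w-below-v ∷ All.map (λ x-below-w → ≤-below-trans o (below⇒≤ p x-below-w) w-below-v) (validOPFrom⇒below w p ps rest)

validOPFrom⇒ordered : ∀ v o ps → T (validOPFrom (v , o) ps) → Ordered ((v , o) ∷ ps)
validOPFrom⇒ordered v o ps t = cons o (All-split (validOPFrom⇒below v o ps t)) (tailOrdered ps t)
  where
  tailOrdered : ∀ ps → T (validOPFrom (v , o) ps) → Ordered ps
  tailOrdered [] _ = [] , []
  tailOrdered ((w , p) ∷ qs) t = validOPFrom⇒ordered w p qs (proj₂ (step⇒ o {v} {w} t))
  cons : ∀ o → All (Below o v) (overlinedParts ps) × All (Below o v) (plainParts ps) → Ordered ps → Ordered ((v , o) ∷ ps)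
  cons true (bound , _) = ∷-overlined-ordered {ps = ps} bound
  cons false (_ , bound) = ∷-plain-ordered {ps = ps} bound

mergeOP-split-∷ : ∀ v o ps → T (validOPFrom (v , o) ps) →
                      mergeOP (overlinedParts ((v , o) ∷ ps)) (plainParts ((v , o) ∷ ps)) ≡ (v , o) ∷ ps
mergeOP-split-∷ v o ps t = cons o (All-split (validOPFrom⇒below v o ps t)) (tailMerge ps t)
  where
  tailMerge : ∀ ps → T (validOPFrom (v , o) ps) → mergeOP (overlinedParts ps) (plainParts ps) ≡ ps
  tailMerge [] _ = refl
  tailMerge ((w , p) ∷ qs) t = mergeOP-split-∷ w p qs (proj₂ (step⇒ o {v} {w} t))
  cons : ∀ o → All (Below o v) (overlinedParts ps) × All (Below o v) (plainParts ps) →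
         mergeOP (overlinedParts ps) (plainParts ps) ≡ ps →
         mergeOP (overlinedParts ((v , o) ∷ ps)) (plainParts ((v , o) ∷ ps)) ≡ (v , o) ∷ ps
  cons true (_ , bound) ih = trans (merge-overlined overlinedFirst (All.map <ᵇ-true bound)) (cong ((v , true) ∷_) ih)
  cons false (bound , _) ih = trans (merge-plain overlinedFirst (All.map <ᵇ-false bound)) (cong ((v , false) ∷_) ih)

validOP⇒ordered : ∀ ps → T (validOP ps) → Ordered ps
validOP⇒ordered [] _ = [] , []
validOP⇒ordered ((v , o) ∷ ps) t = validOPFrom⇒ordered v o ps (proj₂ (∧-elim {allPositive ((v , o) ∷ ps)} t))

validOP⇒positive : ∀ ps → T (validOP ps) → All (1 ≤_) (overlinedParts ps) × All (1 ≤_) (plainParts ps)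
validOP⇒positive [] _ = [] , []
validOP⇒positive (p ∷ ps) t = allPositive⇒positive (p ∷ ps) (proj₁ (∧-elim {allPositive (p ∷ ps)} t))

mergeOP-split : ∀ ps → T (validOP ps) → mergeOP (overlinedParts ps) (plainParts ps) ≡ ps
mergeOP-split [] _ = refl
mergeOP-split ((v , o) ∷ ps) t = mergeOP-split-∷ v o ps (proj₂ (∧-elim {allPositive ((v , o) ∷ ps)} t))

validOPFrom-mergeOP : ∀ v o {os us} → Decreasing os → NonIncreasing us → All (Below o v) os → All (Below o v) us →
                      T (validOPFrom (v , o) (mergeOP os us))
validOPFrom-mergeOP v o {[]} {[]} _ _ _ _ = tt
validOPFrom-mergeOP v o {[]} {u ∷ _} _ ni _ (u-below ∷ _) =
  step⇐ o {v} {u} u-below (validOPFrom-mergeOP u false [] (Linked.tail ni) [] (nonIncreasing⇒bounded ni))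
validOPFrom-mergeOP v o {o′ ∷ _} {[]} dec _ (o′-below ∷ _) _ =
  step⇐ o {v} {o′} o′-below (validOPFrom-mergeOP o′ true (Linked.tail dec) [] (decreasing⇒bounded dec) [])
validOPFrom-mergeOP v o {o′ ∷ _} {u ∷ _} dec ni (o′-below ∷ _) (u-below ∷ _) =
  if-elim (λ ps → T (validOPFrom (v , o) ps)) (u <ᵇ o′)
    (λ u<ᵇo′ → let u<o′ = <ᵇ⇒< u o′ u<ᵇo′ in
      step⇐ o {v} {o′} o′-below
        (validOPFrom-mergeOP o′ true (Linked.tail dec) ni (decreasing⇒bounded dec)
                             (u<o′ ∷ All.map (λ x≤u → ≤-<-trans x≤u u<o′) (nonIncreasing⇒bounded ni))))
    (λ u≮ᵇo′ → let o′≤u = ≮⇒≥ (λ u<o′ → u≮ᵇo′ (<⇒<ᵇ u<o′)) in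
      step⇐ o {v} {u} u-below
        (validOPFrom-mergeOP u false dec (Linked.tail ni)
                             (o′≤u ∷ All.map (λ x<o′ → <⇒≤ (<-≤-trans x<o′ o′≤u)) (decreasing⇒bounded dec))
                             (nonIncreasing⇒bounded ni)))

validOP-mergeOP : ∀ {os us} → Decreasing os → NonIncreasing us → All (1 ≤_) os → All (1 ≤_) us →
                  T (validOP (mergeOP os us))
validOP-mergeOP {os} {us} dec ni pos₁ pos₂ = fromBound (mergeOP os us) chain positive
  where
  -- a virtual first part above every part turns validOP into an instance of validOPFrom
  bound : ℕ
  bound = top os ⊔ top us
  chain : T (validOPFrom (bound , false) (mergeOP os us))
  chain = validOPFrom-mergeOP bound false dec ni
            (All.map (λ x≤top → ≤-trans x≤top (m≤m⊔n _ _)) (decreasing⇒≤top dec))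
            (All.map (λ x≤top → ≤-trans x≤top (m≤n⊔m _ _)) (nonIncreasing⇒≤top ni))
  positive : T (allPositive (mergeOP os us))
  positive = positive⇒allPositive (mergeOP os us)
    (subst (All (1 ≤_)) (sym (overlinedParts-merge overlinedFirst os us)) pos₁)
    (subst (All (1 ≤_)) (sym (plainParts-merge overlinedFirst os us)) pos₂)
  fromBound : ∀ ps → T (validOPFrom (bound , false) ps) → T (allPositive ps) → T (validOP ps)
  fromBound [] _ _ = tt
  fromBound ((w , p) ∷ ps) t pos = ∧-intro pos (proj₂ (step⇒ false {bound} {w} t))

bottomFrom : ℕ → List Part → Bool
bottomFrom v [] = true
bottomFrom v ((w , p) ∷ bs) = (w ≤ᵇ v) ∧ (if p then w <ᵇ v else true) ∧ bottomFrom w bs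

validBottomList : List Part → Bool
validBottomList [] = true
validBottomList ((v , _) ∷ bs) = bottomFrom v bs

validBottom-toList : ∀ {N} (b : Vec Part N) → validBottom b ≡ validBottomList (toList b)
validBottom-toList [] = refl
validBottom-toList ((v , o) ∷ bs) = cons v bs
  where
  cons : ∀ {N} v (bs : Vec Part N) → validBottom ((v , o) ∷ bs) ≡ bottomFrom v (toList bs)
  cons v [] = refl
  cons v ((w , p) ∷ bs) = cong ((w ≤ᵇ v) ∧_) (cong ((if p then w <ᵇ v else true) ∧_) (validBottom-toList ((w , p) ∷ bs)))

overlinedBefore : ℕ → ℕ → Bool
overlinedBefore d m = m ≤ᵇ d

mergeBottom : List ℕ → List ℕ → List Part
mergeBottom = merge overlinedBefore

bottomFrom⇒below : ∀ v ps → T (bottomFrom v ps) → All (λ (w , p) → Below p v w) ps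
bottomFrom⇒below v [] _ = []
bottomFrom⇒below v ((w , p) ∷ ps) t with step⇒ p {v} {w} t
... | w-below-v , rest =
  w-below-v ∷ All.map (λ {(_ , q)} x-below-w → below-≤-trans q x-below-w (below⇒≤ p w-below-v)) (bottomFrom⇒below w ps rest)

bottomFrom⇒ordered : ∀ v o ps → T (bottomFrom v ps) → Ordered ((v , o) ∷ ps)
bottomFrom⇒ordered v o ps t = cons o (All-split (bottomFrom⇒below v ps t)) (tailOrdered ps t)
  where
  tailOrdered : ∀ ps → T (bottomFrom v ps) → Ordered ps
  tailOrdered [] _ = [] , []
  tailOrdered ((w , p) ∷ qs) t = bottomFrom⇒ordered w p qs (proj₂ (step⇒ p {v} {w} t))
  cons : ∀ o → All (_< v) (overlinedParts ps) × All (_≤ v) (plainParts ps) → Ordered ps → Ordered ((v , o) ∷ ps)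
  cons true (bound , _) = ∷-overlined-ordered {ps = ps} bound
  cons false (_ , bound) = ∷-plain-ordered {ps = ps} bound

mergeBottom-split-∷ : ∀ v o ps → T (bottomFrom v ps) →
                         mergeBottom (overlinedParts ((v , o) ∷ ps)) (plainParts ((v , o) ∷ ps)) ≡ (v , o) ∷ ps
mergeBottom-split-∷ v o ps t = cons o (All-split (bottomFrom⇒below v ps t)) (tailMerge ps t)
  where
  tailMerge : ∀ ps → T (bottomFrom v ps) → mergeBottom (overlinedParts ps) (plainParts ps) ≡ ps
  tailMerge [] _ = refl
  tailMerge ((w , p) ∷ qs) t = mergeBottom-split-∷ w p qs (proj₂ (step⇒ p {v} {w} t))
  cons : ∀ o → All (_< v) (overlinedParts ps) × All (_≤ v) (plainParts ps) →
         mergeBottom (overlinedParts ps) (plainParts ps) ≡ ps →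
         mergeBottom (overlinedParts ((v , o) ∷ ps)) (plainParts ((v , o) ∷ ps)) ≡ (v , o) ∷ ps
  cons true (_ , bound) ih = trans (merge-overlined overlinedBefore (All.map ≤ᵇ-true bound)) (cong ((v , true) ∷_) ih)
  cons false (bound , _) ih = trans (merge-plain overlinedBefore (All.map ≤ᵇ-false bound)) (cong ((v , false) ∷_) ih)

validBottomList⇒ordered : ∀ ps → T (validBottomList ps) → Ordered ps
validBottomList⇒ordered [] _ = [] , []
validBottomList⇒ordered ((v , o) ∷ ps) t = bottomFrom⇒ordered v o ps t

mergeBottom-split : ∀ ps → T (validBottomList ps) → mergeBottom (overlinedParts ps) (plainParts ps) ≡ ps
mergeBottom-split [] _ = refl
mergeBottom-split ((v , o) ∷ ps) t = mergeBottom-split-∷ v o ps t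

bottomFrom-mergeBottom : ∀ v {ds ms} → Decreasing ds → NonIncreasing ms → All (_< v) ds → All (_≤ v) ms →
                         T (bottomFrom v (mergeBottom ds ms))
bottomFrom-mergeBottom v {[]} {[]} _ _ _ _ = tt
bottomFrom-mergeBottom v {[]} {m ∷ _} _ ni _ (m≤v ∷ _) =
  step⇐ false {v} {m} m≤v (bottomFrom-mergeBottom m [] (Linked.tail ni) [] (nonIncreasing⇒bounded ni))
bottomFrom-mergeBottom v {d ∷ _} {[]} dec _ (d<v ∷ _) _ =
  step⇐ true {v} {d} d<v (bottomFrom-mergeBottom d (Linked.tail dec) [] (decreasing⇒bounded dec) [])
bottomFrom-mergeBottom v {d ∷ _} {m ∷ _} dec ni (d<v ∷ _) (m≤v ∷ _) =
  if-elim (λ ps → T (bottomFrom v ps)) (m ≤ᵇ d)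
    (λ m≤ᵇd → let m≤d = ≤ᵇ⇒≤ m d m≤ᵇd in
      step⇐ true {v} {d} d<v
        (bottomFrom-mergeBottom d (Linked.tail dec) ni (decreasing⇒bounded dec)
                                (m≤d ∷ All.map (λ x≤m → ≤-trans x≤m m≤d) (nonIncreasing⇒bounded ni))))
    (λ m≰ᵇd → let d<m = ≰⇒> (λ m≤d → m≰ᵇd (≤⇒≤ᵇ m≤d)) in
      step⇐ false {v} {m} m≤v
        (bottomFrom-mergeBottom m dec (Linked.tail ni)
                                (d<m ∷ All.map (λ x<d → <-trans x<d d<m) (decreasing⇒bounded dec))
                                (nonIncreasing⇒bounded ni)))

validBottomList-mergeBottom : ∀ {ds ms} → Decreasing ds → NonIncreasing ms → T (validBottomList (mergeBottom ds ms))
validBottomList-mergeBottom {ds} {ms} dec ni = fromBound (mergeBottom ds ms) chain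
  where
  bound : ℕ
  bound = suc (top ds ⊔ top ms)
  chain : T (bottomFrom bound (mergeBottom ds ms))
  chain = bottomFrom-mergeBottom bound dec ni
            (All.map (λ x≤top → s≤s (≤-trans x≤top (m≤m⊔n _ _))) (decreasing⇒≤top dec))
            (All.map (λ x≤top → m≤n⇒m≤1+n (≤-trans x≤top (m≤n⊔m _ _))) (nonIncreasing⇒≤top ni))
  fromBound : ∀ ps → T (bottomFrom bound ps) → T (validBottomList ps)
  fromBound [] _ = tt
  fromBound ((w , p) ∷ ps) t = proj₂ (step⇒ p {bound} {w} t)

-- The padding (0 , false) is junk: on valid input the list already has length N.
fromListPadded : (N : ℕ) → List Part → Vec Part N
fromListPadded zero _ = []
fromListPadded (suc N) [] = (0 , false) ∷ fromListPadded N []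
fromListPadded (suc N) (p ∷ ps) = p ∷ fromListPadded N ps

toList-fromListPadded : ∀ {N} ps → length ps ≡ N → toList (fromListPadded N ps) ≡ ps
toList-fromListPadded [] refl = refl
toList-fromListPadded (p ∷ ps) refl = cong (p ∷_) (toList-fromListPadded ps refl)

fromListPadded-toList : ∀ {N} (b : Vec Part N) → fromListPadded N (toList b) ≡ b
fromListPadded-toList [] = refl
fromListPadded-toList (p ∷ b) = cong (p ∷_) (fromListPadded-toList b)

sumBottom-toList : ∀ {N} (b : Vec Part N) → sumBottom b ≡ sumParts (toList b)
sumBottom-toList [] = refl
sumBottom-toList ((v , _) ∷ b) = cong (_+_ v) (sumBottom-toList b)

numOverlinedVec-toList : ∀ {N} (b : Vec Part N) → numOverlinedVec b ≡ numOverlined (toList b)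
numOverlinedVec-toList [] = refl
numOverlinedVec-toList ((_ , true) ∷ b) = cong suc (numOverlinedVec-toList b)
numOverlinedVec-toList ((_ , false) ∷ b) = numOverlinedVec-toList b

-- The generalized Durfee square
countGe : ℕ → List ℕ → ℕ
countGe k [] = 0
countGe k (v ∷ vs) = if k ≤ᵇ v then suc (countGe k vs) else countGe k vs

durfeeCount-split : ∀ k ps → durfeeCount k ps ≡ length (overlinedParts ps) + countGe k (plainParts ps)
durfeeCount-split k [] = refl
durfeeCount-split k ((v , true) ∷ ps) = cong suc (durfeeCount-split k ps)
durfeeCount-split k ((v , false) ∷ ps) with k ≤ᵇ v
... | true = trans (cong suc (durfeeCount-split k ps)) (sym (+-suc _ _))
... | false = durfeeCount-split k ps

countGe-++ : ∀ k xs ys → countGe k (xs ++ ys) ≡ countGe k xs + countGe k ys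
countGe-++ k [] ys = refl
countGe-++ k (v ∷ xs) ys with k ≤ᵇ v
... | true = cong suc (countGe-++ k xs ys)
... | false = countGe-++ k xs ys

countGe-all : ∀ k {xs} → All (k ≤_) xs → countGe k xs ≡ length xs
countGe-all k [] = refl
countGe-all k (k≤v ∷ large) rewrite ≤ᵇ-true k≤v = cong suc (countGe-all k large)

countGe-none : ∀ k {xs} → All (_< k) xs → countGe k xs ≡ 0
countGe-none k [] = refl
countGe-none k (v<k ∷ small) rewrite ≤ᵇ-false v<k = countGe-none k small

countGe-zero : ∀ k xs → countGe k xs ≡ 0 → All (_< k) xs
countGe-zero k [] _ = []
countGe-zero k (v ∷ xs) none with k ≤ᵇ v | ≤ᵇ-reflects-≤ k v
... | false | ofⁿ k≰v = ≰⇒> k≰v ∷ countGe-zero k xs none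

take-countGe : ∀ k j {xs} → NonIncreasing xs → j ≤ countGe k xs → All (k ≤_) (take j xs) × j ≤ length xs
take-countGe k zero _ _ = [] , z≤n
take-countGe k (suc j) {v ∷ xs} ni j<count with k ≤ᵇ v | ≤ᵇ-reflects-≤ k v
... | true | ofʸ k≤v =
  let large , j≤length = take-countGe k j (Linked.tail ni) (s≤s⁻¹ j<count) in k≤v ∷ large , s≤s j≤length
... | false | ofⁿ k≰v = ⊥-elim (<⇒≱ (subst (_< suc j) (sym noneLarge) (s≤s z≤n)) j<count)
  where
  noneLarge : countGe k xs ≡ 0
  noneLarge = countGe-none k (All.map (λ x≤v → ≤-<-trans x≤v (≰⇒> k≰v)) (nonIncreasing⇒bounded ni))

drop-countGe : ∀ N j {xs} → NonIncreasing xs → countGe (suc N) xs ≤ j → All (_≤ N) (drop j xs)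
drop-countGe N zero {xs} _ count≤0 = All.map s≤s⁻¹ (countGe-zero (suc N) xs (n≤0⇒n≡0 count≤0))
drop-countGe N (suc j) {[]} _ _ = []
drop-countGe N (suc j) {v ∷ xs} ni count≤j with suc N ≤ᵇ v | ≤ᵇ-reflects-≤ (suc N) v
... | true | _ = drop-countGe N j (Linked.tail ni) (s≤s⁻¹ count≤j)
... | false | ofⁿ v≰N = drop⁺ j (All.map (λ x≤v → ≤-trans x≤v (s≤s⁻¹ (≰⇒> v≰N))) (nonIncreasing⇒bounded ni))

countGe-antitone : ∀ xs {k k′} → k ≤ k′ → countGe k′ xs ≤ countGe k xs
countGe-antitone [] _ = z≤n
countGe-antitone (v ∷ xs) {k} {k′} k≤k′
  with k′ ≤ᵇ v | ≤ᵇ-reflects-≤ k′ v | k ≤ᵇ v | ≤ᵇ-reflects-≤ k v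
... | true  | _         | true  | _        = s≤s (countGe-antitone xs k≤k′)
... | true  | ofʸ k′≤v  | false | ofⁿ k≰v  = ⊥-elim (k≰v (≤-trans k≤k′ k′≤v))
... | false | _         | true  | _        = m≤n⇒m≤1+n (countGe-antitone xs k≤k′)
... | false | _         | false | _        = countGe-antitone xs k≤k′

countGe≤length : ∀ k xs → countGe k xs ≤ length xs
countGe≤length k [] = z≤n
countGe≤length k (v ∷ xs) with k ≤ᵇ v
... | true = s≤s (countGe≤length k xs)
... | false = m≤n⇒m≤1+n (countGe≤length k xs)

durfeeCount-antitone : ∀ ps {k k′} → k ≤ k′ → durfeeCount k′ ps ≤ durfeeCount k ps
durfeeCount-antitone ps {k} {k′} k≤k′ rewrite durfeeCount-split k ps | durfeeCount-split k′ ps =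
  +-monoʳ-≤ (length (overlinedParts ps)) (countGe-antitone (plainParts ps) k≤k′)

durfeeCount≤length : ∀ k ps → durfeeCount k ps ≤ length ps
durfeeCount≤length k ps rewrite durfeeCount-split k ps | length-split ps =
  +-monoʳ-≤ (length (overlinedParts ps)) (countGe≤length k (plainParts ps))

-- As durfeeCount is antitone in the threshold, this singles out the largest N with N ≤ durfeeCount N ps.
IsDurfeeSize : List Part → ℕ → Set
IsDurfeeSize ps N = N ≤ durfeeCount N ps × durfeeCount (suc N) ps ≤ N

durfeeSize-unique : ∀ ps {M N} → IsDurfeeSize ps M → IsDurfeeSize ps N → M ≡ N
durfeeSize-unique ps dM dN = ≤-antisym (below dM dN) (below dN dM)
  where
  below : ∀ {M N} → IsDurfeeSize ps M → IsDurfeeSize ps N → M ≤ N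
  below {M} {N} (M≤count , _) (_ , count≤N) with M ≤? N
  ... | yes M≤N = M≤N
  ... | no M≰N = ⊥-elim (<⇒≱ (s≤s count≤N)
                   (≤-trans (≰⇒> M≰N) (≤-trans M≤count (durfeeCount-antitone ps (≰⇒> M≰N)))))

durfeeSearch-sound : ∀ ps K → durfeeSearch ps K ≤ durfeeCount (durfeeSearch ps K) ps
durfeeSearch-sound ps zero = z≤n
durfeeSearch-sound ps (suc K) with suc K ≤ᵇ durfeeCount (suc K) ps | ≤ᵇ-reflects-≤ (suc K) (durfeeCount (suc K) ps)
... | true | ofʸ ok = ok
... | false | _ = durfeeSearch-sound ps K

durfeeSearch-maximal : ∀ ps K {M} → durfeeSearch ps K < M → M ≤ K → durfeeCount M ps < M
durfeeSearch-maximal ps zero found<M M≤0 = ⊥-elim (<⇒≱ found<M M≤0)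
durfeeSearch-maximal ps (suc K) {M} found<M M≤K
  with suc K ≤ᵇ durfeeCount (suc K) ps | ≤ᵇ-reflects-≤ (suc K) (durfeeCount (suc K) ps)
... | true | _ = ⊥-elim (<⇒≱ found<M M≤K)
... | false | ofⁿ fails with M ≟ suc K
...   | yes refl = ≰⇒> fails
...   | no M≢K = durfeeSearch-maximal ps K found<M (≤-pred (≤∧≢⇒< M≤K M≢K))

durfeeSize-isDurfeeSize : ∀ ps → IsDurfeeSize ps (durfeeSize ps)
durfeeSize-isDurfeeSize ps = durfeeSearch-sound ps (length ps) , ≤-pred next
  where
  next : durfeeCount (suc (durfeeSize ps)) ps < suc (durfeeSize ps)
  next with suc (durfeeSize ps) ≤? length ps
  ... | yes inRange = durfeeSearch-maximal ps (length ps) ≤-refl inRange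
  ... | no outOfRange = ≤-<-trans (durfeeCount≤length _ ps) (≰⇒> outOfRange)

durfeeSize≡ : ∀ ps {N} → IsDurfeeSize ps N → durfeeSize ps ≡ N
durfeeSize≡ ps = durfeeSize-unique ps (durfeeSize-isDurfeeSize ps)

isDurfeeSize-assembled : ∀ N j {os bs ts} → length os + j ≡ N → length bs ≡ j → All (N ≤_) bs → All (_≤ N) ts →
                         IsDurfeeSize (mergeOP os (bs ++ ts)) N
isDurfeeSize-assembled N j {os} {bs} {ts} k+j≡N |bs|≡j large small = atLeast , atMost
  where
  open ≤-Reasoning
  count : ∀ k → durfeeCount k (mergeOP os (bs ++ ts)) ≡ length os + (countGe k bs + countGe k ts)
  count k = trans (durfeeCount-split k (mergeOP os (bs ++ ts)))
            (trans (cong₂ (λ xs ys → length xs + countGe k ys) (overlinedParts-merge overlinedFirst os _)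
                                                              (plainParts-merge overlinedFirst os _))
                   (cong (_+_ (length os)) (countGe-++ k bs ts)))
  atLeast : N ≤ durfeeCount N (mergeOP os (bs ++ ts))
  atLeast = begin
    N                                         ≡⟨ k+j≡N ⟨
    length os + j                             ≡⟨ cong (_+_ (length os)) (trans (countGe-all N large) |bs|≡j) ⟨
    length os + countGe N bs                  ≤⟨ +-monoʳ-≤ (length os) (m≤m+n _ _) ⟩
    length os + (countGe N bs + countGe N ts) ≡⟨ count N ⟨
    durfeeCount N (mergeOP os (bs ++ ts))     ∎
  atMost : durfeeCount (suc N) (mergeOP os (bs ++ ts)) ≤ N
  atMost = begin
    durfeeCount (suc N) (mergeOP os (bs ++ ts))           ≡⟨ count (suc N) ⟩
    length os + (countGe (suc N) bs + countGe (suc N) ts) ≡⟨ cong (λ c → length os + (countGe (suc N) bs + c)) (countGe-none (suc N) (All.map s≤s small)) ⟩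
    length os + (countGe (suc N) bs + 0)                  ≡⟨ cong (_+_ (length os)) (+-identityʳ _) ⟩
    length os + countGe (suc N) bs                        ≤⟨ +-monoʳ-≤ (length os) (countGe≤length (suc N) bs) ⟩
    length os + length bs                                 ≡⟨ cong (_+_ (length os)) |bs|≡j ⟩
    length os + j                                         ≡⟨ k+j≡N ⟩
    N                                                     ∎

isDurfeeSize⇒split : ∀ N j ps → NonIncreasing (plainParts ps) → length (overlinedParts ps) + j ≡ N → IsDurfeeSize ps N →
                     All (N ≤_) (take j (plainParts ps)) × j ≤ length (plainParts ps) × All (_≤ N) (drop j (plainParts ps))
isDurfeeSize⇒split N j ps ni refl (atLeast , atMost) =
  let large , j≤length = take-countGe N j ni j≤count in large , j≤length , drop-countGe N j ni count≤j
  where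
  k : ℕ
  k = length (overlinedParts ps)
  j≤count : j ≤ countGe N (plainParts ps)
  j≤count = +-cancelˡ-≤ k j _ (subst (k + j ≤_) (durfeeCount-split N ps) atLeast)
  count≤j : countGe (suc N) (plainParts ps) ≤ j
  count≤j = +-cancelˡ-≤ k _ j (subst (_≤ k + j) (durfeeCount-split (suc N) ps) atMost)

-- Encoding bottom-row entries as parts
overlinedPartsOf : List ℕ → List ℕ
overlinedPartsOf ms = map suc (stair ms)

plainEntriesOf : List ℕ → List ℕ
plainEntriesOf os = unstair (map pred os)

largePartsOf : ℕ → List ℕ → List ℕ
largePartsOf N ds = map (_+_ N) (unstair ds)

overlinedEntriesOf : ℕ → List ℕ → List ℕ
overlinedEntriesOf N bs = stair (map (_∸ N) bs)

overlinedPartsOf-decreasing : ∀ {ms} → NonIncreasing ms → Decreasing (overlinedPartsOf ms)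
overlinedPartsOf-decreasing ni = Linkedₚ.map⁺ (Linked.map s≤s (stair-decreasing ni))

overlinedPartsOf-positive : ∀ ms → All (1 ≤_) (overlinedPartsOf ms)
overlinedPartsOf-positive ms = Allₚ.map⁺ (All.universal (λ _ → s≤s z≤n) (stair ms))

map-pred-decreasing : ∀ {os} → Decreasing os → All (1 ≤_) os → Decreasing (map pred os)
map-pred-decreasing [] _ = []
map-pred-decreasing [-] _ = [-]
map-pred-decreasing {suc _ ∷ suc _ ∷ _} (s≤s y<x ∷ rest) (_ ∷ pos) = y<x ∷ map-pred-decreasing rest pos
map-pred-decreasing {_ ∷ zero ∷ _} _ (_ ∷ () ∷ _)

plainEntriesOf-nonIncreasing : ∀ {os} → Decreasing os → All (1 ≤_) os → NonIncreasing (plainEntriesOf os)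
plainEntriesOf-nonIncreasing dec pos = unstair-nonIncreasing (map-pred-decreasing dec pos)

pred-map-suc : ∀ xs → map pred (map suc xs) ≡ xs
pred-map-suc xs = trans (sym (map-∘ xs)) (map-id xs)

suc-map-pred : ∀ {xs} → All (1 ≤_) xs → map suc (map pred xs) ≡ xs
suc-map-pred {xs} pos = trans (sym (map-∘ xs)) (map-id-local (All.map (λ { {suc _} _ → refl }) pos))

plainEntriesOf-overlinedPartsOf : ∀ ms → plainEntriesOf (overlinedPartsOf ms) ≡ ms
plainEntriesOf-overlinedPartsOf ms = trans (cong unstair (pred-map-suc (stair ms))) (unstair-stair ms)

overlinedPartsOf-plainEntriesOf : ∀ {os} → Decreasing os → All (1 ≤_) os → overlinedPartsOf (plainEntriesOf os) ≡ os
overlinedPartsOf-plainEntriesOf {os} dec pos =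
  trans (cong (map suc) (stair-unstair (map-pred-decreasing dec pos))) (suc-map-pred pos)

length-overlinedPartsOf : ∀ ms → length (overlinedPartsOf ms) ≡ length ms
length-overlinedPartsOf ms = trans (length-map suc (stair ms)) (length-stair ms)

length-plainEntriesOf : ∀ os → length (plainEntriesOf os) ≡ length os
length-plainEntriesOf os = trans (length-unstair (map pred os)) (length-map pred os)

sum-overlinedPartsOf : ∀ ms → sum (overlinedPartsOf ms) ≡ length ms + (sum ms + triangle (length ms))
sum-overlinedPartsOf ms = begin
  sum (map suc (stair ms))                    ≡⟨ sum-map-+ 1 (stair ms) ⟩
  length (stair ms) * 1 + sum (stair ms)      ≡⟨ cong₂ _+_ (trans (*-identityʳ _) (length-stair ms)) (sum-stair ms) ⟩
  length ms + (sum ms + triangle (length ms)) ∎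
  where open ≡-Reasoning

largePartsOf-nonIncreasing : ∀ N {ds} → Decreasing ds → NonIncreasing (largePartsOf N ds)
largePartsOf-nonIncreasing N dec = Linkedₚ.map⁺ (Linked.map (+-monoʳ-≤ N) (unstair-nonIncreasing dec))

largePartsOf-≥ : ∀ N ds → All (N ≤_) (largePartsOf N ds)
largePartsOf-≥ N ds = Allₚ.map⁺ (All.universal (m≤m+n N) (unstair ds))

overlinedEntriesOf-decreasing : ∀ N {bs} → NonIncreasing bs → Decreasing (overlinedEntriesOf N bs)
overlinedEntriesOf-decreasing N ni = stair-decreasing (Linkedₚ.map⁺ (Linked.map (∸-monoˡ-≤ N) ni))

overlinedEntriesOf-largePartsOf : ∀ N {ds} → Decreasing ds → overlinedEntriesOf N (largePartsOf N ds) ≡ ds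
overlinedEntriesOf-largePartsOf N {ds} dec = begin
  stair (map (_∸ N) (map (_+_ N) (unstair ds))) ≡⟨ cong stair (map-∘ (unstair ds)) ⟨
  stair (map (λ x → N + x ∸ N) (unstair ds))    ≡⟨ cong stair (map-id-local (All.universal (m+n∸m≡n N) (unstair ds))) ⟩
  stair (unstair ds)                            ≡⟨ stair-unstair dec ⟩
  ds                                            ∎
  where open ≡-Reasoning

largePartsOf-overlinedEntriesOf : ∀ N {bs} → All (N ≤_) bs → largePartsOf N (overlinedEntriesOf N bs) ≡ bs
largePartsOf-overlinedEntriesOf N {bs} large = begin
  map (_+_ N) (unstair (stair (map (_∸ N) bs))) ≡⟨ cong (map (_+_ N)) (unstair-stair (map (_∸ N) bs)) ⟩
  map (_+_ N) (map (_∸ N) bs)                   ≡⟨ map-∘ bs ⟨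
  map (λ x → N + (x ∸ N)) bs                    ≡⟨ map-id-local (All.map m+[n∸m]≡n large) ⟩
  bs                                            ∎
  where open ≡-Reasoning

length-largePartsOf : ∀ N ds → length (largePartsOf N ds) ≡ length ds
length-largePartsOf N ds = trans (length-map (_+_ N) (unstair ds)) (length-unstair ds)

length-overlinedEntriesOf : ∀ N bs → length (overlinedEntriesOf N bs) ≡ length bs
length-overlinedEntriesOf N bs = trans (length-stair (map (_∸ N) bs)) (length-map (_∸ N) bs)

sum-largePartsOf : ∀ N {ds} → Decreasing ds → sum (largePartsOf N ds) + triangle (length ds) ≡ length ds * N + sum ds
sum-largePartsOf N {ds} dec = begin
  sum (map (_+_ N) (unstair ds)) + triangle (length ds)
    ≡⟨ cong (_+ triangle (length ds)) (sum-map-+ N (unstair ds)) ⟩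
  length (unstair ds) * N + sum (unstair ds) + triangle (length ds)
    ≡⟨ cong (λ n → n * N + sum (unstair ds) + triangle (length ds)) (length-unstair ds) ⟩
  length ds * N + sum (unstair ds) + triangle (length ds)
    ≡⟨ +-assoc (length ds * N) _ _ ⟩
  length ds * N + (sum (unstair ds) + triangle (length ds))
    ≡⟨ cong (λ n → length ds * N + (sum (unstair ds) + triangle n)) (length-unstair ds) ⟨
  length ds * N + (sum (unstair ds) + triangle (length (unstair ds)))
    ≡⟨ cong (_+_ (length ds * N)) (sum-stair (unstair ds)) ⟨
  length ds * N + sum (stair (unstair ds))
    ≡⟨ cong (λ xs → length ds * N + sum xs) (stair-unstair dec) ⟩
  length ds * N + sum ds ∎
  where open ≡-Reasoning

weight-balance : ∀ k j → (k + j) + triangle (k + j) + triangle j ≡ k + triangle k + j * (k + j)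
weight-balance k j = begin
  k + j + triangle (k + j) + triangle j                  ≡⟨ cong (λ t → k + j + t + triangle j) (triangle-+ k j) ⟩
  k + j + (triangle k + triangle j + k * j) + triangle j ≡⟨ rearrange k j (triangle k) (triangle j) ⟩
  k + triangle k + k * j + (j + triangle j + triangle j) ≡⟨ cong (_+_ (k + triangle k + k * j)) (triangle-double j) ⟩
  k + triangle k + k * j + j * j                         ≡⟨ expand k j (triangle k) ⟩
  k + triangle k + j * (k + j)                           ∎
  where
  open ≡-Reasoning
  rearrange : ∀ k j a b → k + j + (a + b + k * j) + b ≡ k + a + k * j + (j + b + b)
  rearrange = solve-∀
  expand : ∀ k j a → k + a + k * j + j * j ≡ k + a + j * (k + j)
  expand = solve-∀

weight-preserved : ∀ {N ds ms ts} → Decreasing ds → PartsAtMost N ts → length ms + length ds ≡ N →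
                N + (sumVec (topRow N ts) + (sum ds + sum ms))
                  ≡ sum (overlinedPartsOf ms) + (sum (largePartsOf N ds) + sum ts)
-- Both sides are compared after adding triangle j, which avoids truncated subtraction.
weight-preserved {ds = ds} {ms} {ts} dec tail refl = +-cancelʳ-≡ (triangle j) _ _ (begin
  N + (sumVec (topRow N ts) + (sum ds + sum ms)) + triangle j
    ≡⟨ cong (λ s → N + (s + (sum ds + sum ms)) + triangle j) (sum-topRow N tail) ⟩
  N + (triangle N + sum ts + (sum ds + sum ms)) + triangle j
    ≡⟨ shuffle₁ N (triangle N) (triangle j) (sum ts) (sum ds) (sum ms) ⟩
  N + triangle N + triangle j + (sum ts + sum ds + sum ms)
    ≡⟨ cong (_+ (sum ts + sum ds + sum ms)) (weight-balance k j) ⟩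
  k + triangle k + j * N + (sum ts + sum ds + sum ms)
    ≡⟨ shuffle₂ k (triangle k) (j * N) (sum ts) (sum ds) (sum ms) ⟩
  k + (sum ms + triangle k) + (j * N + sum ds + sum ts)
    ≡⟨ cong₂ (λ o l → o + (l + sum ts)) (sum-overlinedPartsOf ms) (sum-largePartsOf N dec) ⟨
  sum (overlinedPartsOf ms) + (sum (largePartsOf N ds) + triangle j + sum ts)
    ≡⟨ shuffle₃ (sum (overlinedPartsOf ms)) (sum (largePartsOf N ds)) (triangle j) (sum ts) ⟩
  sum (overlinedPartsOf ms) + (sum (largePartsOf N ds) + sum ts) + triangle j ∎)
  where
  open ≡-Reasoning
  k j N : ℕ
  k = length ms
  j = length ds
  N = k + j
  shuffle₁ : ∀ n tn tj st sd sm → n + (tn + st + (sd + sm)) + tj ≡ n + tn + tj + (st + sd + sm)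
  shuffle₁ = solve-∀
  shuffle₂ : ∀ k tk jn st sd sm → k + tk + jn + (st + sd + sm) ≡ k + (sm + tk) + (jn + sd + st)
  shuffle₂ = solve-∀
  shuffle₃ : ∀ o l tj st → o + (l + tj + st) ≡ o + (l + st) + tj
  shuffle₃ = solve-∀

k+j≡N⇒k≡N-j : ∀ {k j N} → k + j ≡ N → + k ≡ + N - + j
k+j≡N⇒k≡N-j {k} {j} refl = sym (begin
  + (k + j) - + j  ≡⟨ ℤ.[+m]-[+n]≡m⊖n (k + j) j ⟩
  (k + j) ⊖ j      ≡⟨ ℤ.⊖-≥ (m≤n+m j k) ⟩
  + (k + j ∸ j)    ≡⟨ cong +_ (m+n∸n≡m k j) ⟩
  + k              ∎)
  where open ≡-Reasoning

k≡N-j⇒k+j≡N : ∀ {k j N} → + k ≡ + N - + j → k + j ≡ N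
k≡N-j⇒k+j≡N {k} {j} {N} k≡N-j = ℤ.+-injective (begin
  + (k + j)           ≡⟨ ℤ.pos-+ k j ⟩
  + k ℤ+ + j          ≡⟨ cong (_ℤ+ + j) (trans k≡N-j (ℤ.[+m]-[+n]≡m⊖n N j)) ⟩
  N ⊖ j ℤ+ + j        ≡⟨ ℤ.distribˡ-⊖-+-pos j N j ⟩
  N + j ⊖ j           ≡⟨ ℤ.⊖-≥ (m≤n+m j N) ⟩
  + (N + j ∸ j)       ≡⟨ cong +_ (m+n∸n≡m N j) ⟩
  + N                 ∎)
  where open ≡-Reasoning

frobeniusConditions : (n N j : ℕ) → Vec ℕ N → Vec Part N → Bool
frobeniusConditions n N j a b = strictDecr a ∧ validBottom b ∧ (frobWeight a b ≡ᵇ n) ∧ (numOverlinedVec b ≡ᵇ j)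

overpartitionConditions : (n N j : ℕ) → List Part → Bool
overpartitionConditions n N j ps =
  validOP ps ∧ (sumParts ps ≡ᵇ n) ∧ (durfeeSize ps ≡ᵇ N) ∧ ⌊ + numOverlined ps ℤ.≟ (+ N - + j) ⌋

toOverpartition : (N : ℕ) → Vec ℕ N → Vec Part N → List Part
toOverpartition N a b =
  mergeOP (overlinedPartsOf (plainParts (toList b))) (largePartsOf N (overlinedParts (toList b)) ++ tailOf a)

toFrobenius : (N j : ℕ) → List Part → Vec ℕ N × Vec Part N
toFrobenius N j ps =
  topRow N (drop j (plainParts ps)) ,
  fromListPadded N (mergeBottom (overlinedEntriesOf N (take j (plainParts ps))) (plainEntriesOf (overlinedParts ps)))

module FromFrobenius (n N j : ℕ) (a : Vec ℕ N) (b : Vec Part N)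
  (valid : T (frobeniusConditions n N j a b)) where

  conditions : T (strictDecr a) × T (validBottom b) × T (frobWeight a b ≡ᵇ n) × T (numOverlinedVec b ≡ᵇ j)
  conditions = ∧-elim₄ {strictDecr a} {validBottom b} {frobWeight a b ≡ᵇ n} valid

  a-decreasing : T (strictDecr a)
  a-decreasing = proj₁ conditions

  weight : frobWeight a b ≡ n
  weight = ≡ᵇ⇒≡ (frobWeight a b) n (proj₁ (proj₂ (proj₂ conditions)))

  bottom : List Part
  bottom = toList b

  bottom-valid : T (validBottomList bottom)
  bottom-valid = subst T (validBottom-toList b) (proj₁ (proj₂ conditions))

  ds ms ts os bs : List ℕ
  ds = overlinedParts bottom
  ms = plainParts bottom
  ts = tailOf a
  os = overlinedPartsOf ms
  bs = largePartsOf N ds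

  λ′ : List Part
  λ′ = toOverpartition N a b

  bottomOrdered : Ordered bottom
  bottomOrdered = validBottomList⇒ordered bottom bottom-valid

  |ds|≡j : length ds ≡ j
  |ds|≡j = trans (sym (numOverlined≡length bottom))
                 (trans (sym (numOverlinedVec-toList b)) (≡ᵇ⇒≡ (numOverlinedVec b) j (proj₂ (proj₂ (proj₂ conditions)))))

  |ms|+|ds|≡N : length ms + length ds ≡ N
  |ms|+|ds|≡N = trans (+-comm (length ms) (length ds)) (trans (sym (length-split bottom)) (length-toList b))

  |ms|+j≡N : length ms + j ≡ N
  |ms|+j≡N = subst (λ i → length ms + i ≡ N) |ds|≡j |ms|+|ds|≡N

  |bs|≡j : length bs ≡ j
  |bs|≡j = trans (length-largePartsOf N ds) |ds|≡j

  |os|+j≡N : length os + j ≡ N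
  |os|+j≡N = trans (cong (_+ j) (length-overlinedPartsOf ms)) |ms|+j≡N

  tail : PartsAtMost N ts
  tail = tailOf-partsAtMost a a-decreasing

  overlined-λ′ : overlinedParts λ′ ≡ os
  overlined-λ′ = overlinedParts-merge overlinedFirst os (bs ++ ts)

  plain-λ′ : plainParts λ′ ≡ bs ++ ts
  plain-λ′ = plainParts-merge overlinedFirst os (bs ++ ts)

  |bs|≤N : length bs ≤ N
  |bs|≤N = subst (_≤ N) (sym |bs|≡j) (subst (j ≤_) |ms|+j≡N (m≤n+m j (length ms)))

  validOP-λ′ : T (validOP λ′)
  validOP-λ′ = validOP-mergeOP
    (overlinedPartsOf-decreasing (proj₂ bottomOrdered))
    (++-nonIncreasing N (largePartsOf-nonIncreasing N (proj₁ bottomOrdered)) (proj₁ tail)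
                        (largePartsOf-≥ N ds) (All.map proj₂ (proj₂ tail)))
    (overlinedPartsOf-positive ms)
    (++⁺ (bounded⇒positive (largePartsOf-≥ N ds) |bs|≤N) (partsAtMost⇒positive tail))

  sum-λ′ : sumParts λ′ ≡ n
  sum-λ′ = begin
    sumParts λ′
      ≡⟨ sumParts-split λ′ ⟩
    sum (overlinedParts λ′) + sum (plainParts λ′)
      ≡⟨ cong₂ (λ xs ys → sum xs + sum ys) overlined-λ′ plain-λ′ ⟩
    sum os + sum (bs ++ ts)
      ≡⟨ cong (_+_ (sum os)) (sum-++ bs ts) ⟩
    sum os + (sum bs + sum ts)
      ≡⟨ weight-preserved {ms = ms} (proj₁ bottomOrdered) tail |ms|+|ds|≡N ⟨
    N + (sumVec (topRow N ts) + (sum ds + sum ms))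
      ≡⟨ cong₂ (λ a′ s → N + (sumVec a′ + s)) (topRow-tailOf a a-decreasing)
               (sym (trans (sumBottom-toList b) (sumParts-split bottom))) ⟩
    frobWeight a b
      ≡⟨ weight ⟩
    n ∎
    where open ≡-Reasoning

  durfee-λ′ : durfeeSize λ′ ≡ N
  durfee-λ′ = durfeeSize≡ λ′
    (isDurfeeSize-assembled N j {os} |os|+j≡N |bs|≡j (largePartsOf-≥ N ds) (All.map proj₂ (proj₂ tail)))

  numOverlined-λ′ : + numOverlined λ′ ≡ + N - + j
  numOverlined-λ′ = k+j≡N⇒k≡N-j
    (trans (cong (_+ j) (trans (numOverlined≡length λ′) (cong length overlined-λ′))) |os|+j≡N)

  overpartition-valid : T (overpartitionConditions n N j λ′)
  overpartition-valid = ∧-intro₄ validOP-λ′ (≡⇒≡ᵇ _ _ sum-λ′) (≡⇒≡ᵇ _ _ durfee-λ′) (fromWitness numOverlined-λ′)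

  toFrobenius-toOverpartition : toFrobenius N j λ′ ≡ (a , b)
  toFrobenius-toOverpartition = cong₂ _,_ topRowEq bottomEq
    where
    open ≡-Reasoning
    take-plain : take j (plainParts λ′) ≡ bs
    take-plain = trans (cong (take j) plain-λ′) (subst (λ i → take i (bs ++ ts) ≡ bs) |bs|≡j (take-++-length bs ts))
    drop-plain : drop j (plainParts λ′) ≡ ts
    drop-plain = trans (cong (drop j) plain-λ′) (subst (λ i → drop i (bs ++ ts) ≡ ts) |bs|≡j (drop-++-length bs ts))
    topRowEq : topRow N (drop j (plainParts λ′)) ≡ a
    topRowEq = trans (cong (topRow N) drop-plain) (topRow-tailOf a a-decreasing)
    bottomEq : fromListPadded N (mergeBottom (overlinedEntriesOf N (take j (plainParts λ′))) (plainEntriesOf (overlinedParts λ′))) ≡ b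
    bottomEq = begin
      fromListPadded N (mergeBottom (overlinedEntriesOf N (take j (plainParts λ′))) (plainEntriesOf (overlinedParts λ′)))
        ≡⟨ cong₂ (λ d m → fromListPadded N (mergeBottom d m))
                 (trans (cong (overlinedEntriesOf N) take-plain) (overlinedEntriesOf-largePartsOf N (proj₁ bottomOrdered)))
                 (trans (cong plainEntriesOf overlined-λ′) (plainEntriesOf-overlinedPartsOf ms)) ⟩
      fromListPadded N (mergeBottom ds ms)
        ≡⟨ cong (fromListPadded N) (mergeBottom-split bottom bottom-valid) ⟩
      fromListPadded N bottom
        ≡⟨ fromListPadded-toList b ⟩
      b ∎

module FromOverpartition (n N j : ℕ) (λ′ : List Part)
  (valid : T (overpartitionConditions n N j λ′)) where

  conditions : T (validOP λ′) × T (sumParts λ′ ≡ᵇ n) × T (durfeeSize λ′ ≡ᵇ N) × T ⌊ + numOverlined λ′ ℤ.≟ (+ N - + j) ⌋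
  conditions = ∧-elim₄ {validOP λ′} {sumParts λ′ ≡ᵇ n} {durfeeSize λ′ ≡ᵇ N} valid

  λ′-validOP : T (validOP λ′)
  λ′-validOP = proj₁ conditions

  weight : sumParts λ′ ≡ n
  weight = ≡ᵇ⇒≡ (sumParts λ′) n (proj₁ (proj₂ conditions))

  durfee : durfeeSize λ′ ≡ N
  durfee = ≡ᵇ⇒≡ (durfeeSize λ′) N (proj₁ (proj₂ (proj₂ conditions)))

  os μ bs ts ds ms : List ℕ
  os = overlinedParts λ′
  μ = plainParts λ′
  bs = take j μ
  ts = drop j μ
  ds = overlinedEntriesOf N bs
  ms = plainEntriesOf os

  bottom : List Part
  bottom = mergeBottom ds ms

  a′ : Vec ℕ N
  a′ = topRow N ts

  b′ : Vec Part N
  b′ = fromListPadded N bottom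

  ordered : Ordered λ′
  ordered = validOP⇒ordered λ′ λ′-validOP

  positive : All (1 ≤_) os × All (1 ≤_) μ
  positive = validOP⇒positive λ′ λ′-validOP

  |os|+j≡N : length os + j ≡ N
  |os|+j≡N = k≡N-j⇒k+j≡N (trans (cong +_ (sym (numOverlined≡length λ′))) (toWitness (proj₂ (proj₂ (proj₂ conditions)))))

  plainSplit : All (N ≤_) bs × j ≤ length μ × All (_≤ N) ts
  plainSplit = isDurfeeSize⇒split N j λ′ (proj₂ ordered) |os|+j≡N (subst (IsDurfeeSize λ′) durfee (durfeeSize-isDurfeeSize λ′))

  |bs|≡j : length bs ≡ j
  |bs|≡j = length-take≡ j (proj₁ (proj₂ plainSplit))

  |ds|≡j : length ds ≡ j
  |ds|≡j = trans (length-overlinedEntriesOf N bs) |bs|≡j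

  |ms|+j≡N : length ms + j ≡ N
  |ms|+j≡N = trans (cong (_+ j) (length-plainEntriesOf os)) |os|+j≡N

  |ms|+|ds|≡N : length ms + length ds ≡ N
  |ms|+|ds|≡N = trans (cong (_+_ (length ms)) |ds|≡j) |ms|+j≡N

  tail : PartsAtMost N ts
  tail = drop-nonIncreasing j (proj₂ ordered) , All.zip (drop⁺ j (proj₂ positive) , proj₂ (proj₂ plainSplit))

  ds-decreasing : Decreasing ds
  ds-decreasing = overlinedEntriesOf-decreasing N (take-nonIncreasing j (proj₂ ordered))

  ms-nonIncreasing : NonIncreasing ms
  ms-nonIncreasing = plainEntriesOf-nonIncreasing (proj₁ ordered) (proj₁ positive)

  overlined-bottom : overlinedParts bottom ≡ ds
  overlined-bottom = overlinedParts-merge overlinedBefore ds ms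

  plain-bottom : plainParts bottom ≡ ms
  plain-bottom = plainParts-merge overlinedBefore ds ms

  toList-b′ : toList b′ ≡ bottom
  toList-b′ = toList-fromListPadded bottom (begin
    length bottom                                               ≡⟨ length-split bottom ⟩
    length (overlinedParts bottom) + length (plainParts bottom) ≡⟨ cong₂ (λ xs ys → length xs + length ys)
                                                                         overlined-bottom plain-bottom ⟩
    length ds + length ms                                       ≡⟨ +-comm (length ds) (length ms) ⟩
    length ms + length ds                                       ≡⟨ |ms|+|ds|≡N ⟩
    N                                                           ∎)
    where open ≡-Reasoning

  os-roundTrip : overlinedPartsOf ms ≡ os
  os-roundTrip = overlinedPartsOf-plainEntriesOf (proj₁ ordered) (proj₁ positive)

  bs-roundTrip : largePartsOf N ds ≡ bs
  bs-roundTrip = largePartsOf-overlinedEntriesOf N (proj₁ plainSplit)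

  b′-valid : T (validBottom b′)
  b′-valid = subst T (sym (trans (validBottom-toList b′) (cong validBottomList toList-b′)))
                     (validBottomList-mergeBottom ds-decreasing ms-nonIncreasing)

  numOverlined-b′ : numOverlinedVec b′ ≡ j
  numOverlined-b′ = begin
    numOverlinedVec b′               ≡⟨ numOverlinedVec-toList b′ ⟩
    numOverlined (toList b′)         ≡⟨ cong numOverlined toList-b′ ⟩
    numOverlined bottom              ≡⟨ numOverlined≡length bottom ⟩
    length (overlinedParts bottom)   ≡⟨ cong length overlined-bottom ⟩
    length ds                        ≡⟨ |ds|≡j ⟩
    j                                ∎
    where open ≡-Reasoning

  weight-b′ : frobWeight a′ b′ ≡ n
  weight-b′ = begin
    N + (sumVec a′ + sumBottom b′)
      ≡⟨ cong (λ s → N + (sumVec a′ + s)) sumBottom-b′ ⟩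
    N + (sumVec (topRow N ts) + (sum ds + sum ms))
      ≡⟨ weight-preserved {ms = ms} ds-decreasing tail |ms|+|ds|≡N ⟩
    sum (overlinedPartsOf ms) + (sum (largePartsOf N ds) + sum ts)
      ≡⟨ cong₂ (λ xs ys → sum xs + (sum ys + sum ts)) os-roundTrip bs-roundTrip ⟩
    sum os + (sum bs + sum ts)
      ≡⟨ cong (_+_ (sum os)) (trans (cong sum (sym (take++drop≡id j μ))) (sum-++ bs ts)) ⟨
    sum os + sum μ
      ≡⟨ sumParts-split λ′ ⟨
    sumParts λ′
      ≡⟨ weight ⟩
    n ∎
    where
    open ≡-Reasoning
    sumBottom-b′ : sumBottom b′ ≡ sum ds + sum ms
    sumBottom-b′ = begin
      sumBottom b′                                          ≡⟨ sumBottom-toList b′ ⟩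
      sumParts (toList b′)                                  ≡⟨ cong sumParts toList-b′ ⟩
      sumParts bottom                                       ≡⟨ sumParts-split bottom ⟩
      sum (overlinedParts bottom) + sum (plainParts bottom) ≡⟨ cong₂ (λ xs ys → sum xs + sum ys) overlined-bottom plain-bottom ⟩
      sum ds + sum ms                                       ∎

  frobenius-valid : T (frobeniusConditions n N j a′ b′)
  frobenius-valid = ∧-intro₄ (topRow-decreasing N ts) b′-valid (≡⇒≡ᵇ _ _ weight-b′) (≡⇒≡ᵇ _ _ numOverlined-b′)

  toOverpartition-toFrobenius : toOverpartition N a′ b′ ≡ λ′
  toOverpartition-toFrobenius = begin
    mergeOP (overlinedPartsOf (plainParts (toList b′))) (largePartsOf N (overlinedParts (toList b′)) ++ tailOf a′)
      ≡⟨ cong (λ xs → mergeOP (overlinedPartsOf (plainParts xs)) (largePartsOf N (overlinedParts xs) ++ tailOf a′)) toList-b′ ⟩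
    mergeOP (overlinedPartsOf (plainParts bottom)) (largePartsOf N (overlinedParts bottom) ++ tailOf a′)
      ≡⟨ cong₂ (λ xs ys → mergeOP (overlinedPartsOf xs) (largePartsOf N ys ++ tailOf a′)) plain-bottom overlined-bottom ⟩
    mergeOP (overlinedPartsOf ms) (largePartsOf N ds ++ tailOf a′)
      ≡⟨ cong₂ mergeOP os-roundTrip (cong₂ _++_ bs-roundTrip (tailOf-topRow N tail)) ⟩
    mergeOP os (bs ++ ts)
      ≡⟨ cong (mergeOP os) (take++drop≡id j μ) ⟩
    mergeOP os μ
      ≡⟨ mergeOP-split λ′ λ′-validOP ⟩
    λ′ ∎
    where open ≡-Reasoning

proposition2p2 : (N j n : ℕ) → FrobeniusSymbols n N j ⤖ OverpartitionsDurfee n N (+ N - + j)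
proposition2p2 N j n = ↔⇒⤖ (mk↔ₛ′ to from to∘from from∘to)
  where
  to : FrobeniusSymbols n N j → OverpartitionsDurfee n N (+ N - + j)
  to ((a , b) , valid) = toOverpartition N a b , FromFrobenius.overpartition-valid n N j a b valid
  from : OverpartitionsDurfee n N (+ N - + j) → FrobeniusSymbols n N j
  from (λ′ , valid) = toFrobenius N j λ′ , FromOverpartition.frobenius-valid n N j λ′ valid
  to∘from : ∀ y → to (from y) ≡ y
  to∘from (λ′ , valid) = Σ-≡,≡→≡ (FromOverpartition.toOverpartition-toFrobenius n N j λ′ valid , T-irrelevant _ _)
  from∘to : ∀ x → from (to x) ≡ x
  from∘to ((a , b) , valid) = Σ-≡,≡→≡ (FromFrobenius.toFrobenius-toOverpartition n N j a b valid , T-irrelevant _ _)
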